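{- Let $s,t\ge2$ and let $L_{\mathrm{bal}}(s,t)$ be the largest positive integer $n$ for which there is a coloring of $\{1,\ldots,n\}$ with colors $0$ and $1$ such that the two color classes have sizes differing by at most one, the color-$0$ class contains no $s$ pairwise coprime integers, and the color-$1$ class contains no $t$ pairwise coprime integers. Then $L_{\mathrm{bal}}(s,t)=p_{s+t-2}-1$, where $p_m$ is the $m$-th prime ($p_1=2$).
   Context: A set of pairwise coprime integers means a set of distinct positive integers any two of which have greatest common divisor $1$. -}

module Defs where

open import Data.Nat using (ℕ; suc; _≤_; _<_; _∸_; _+_)
open import Data.Nat.GCD using (gcd)
open import Data.Nat.Primality using (Prime; prime?)
open import Data.Bool using (Bool; true; false)
open import Data.Bool.Properties using () renaming (_≟_ to _≟ᵇ_)
open import Data.Fin using (Fin; toℕ)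
open import Data.List using (List; length; filter; allFin; upTo)
open import Data.Product using (Σ; _×_; ∃)
open import Relation.Binary.PropositionalEquality using (_≡_; _≢_)
open import Relation.Nullary using (¬_)
open import Function.Definitions using (Injective)

-- A 2-colouring of {1,…,n}: element i : Fin n stands for the integer toℕ i + 1;
-- colour 0 is false, colour 1 is true.
Colouring : ℕ → Set
Colouring n = Fin n → Bool

val : ∀ {n} → Fin n → ℕ
val i = suc (toℕ i)

classSize : ∀ {n} → Colouring n → Bool → ℕ
classSize {n} c b = length (filter (λ i → c i ≟ᵇ b) (allFin n))

Balanced : ∀ {n} → Colouring n → Set
Balanced c = classSize c false ≤ suc (classSize c true)
           × classSize c true ≤ suc (classSize c false)

HasCoprimeSet : ∀ {n} → Colouring n → Bool → ℕ → Set
HasCoprimeSet {n} c b k =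
  Σ (Fin k → Fin n) λ f →
    Injective _≡_ _≡_ f
    × (∀ i → c (f i) ≡ b)
    × (∀ i j → i ≢ j → gcd (val (f i)) (val (f j)) ≡ 1)

GoodBalanced : ℕ → ℕ → ℕ → Set
GoodBalanced s t n =
  Σ (Colouring n) λ c →
    Balanced c × ¬ HasCoprimeSet c false s × ¬ HasCoprimeSet c true t

IsLbal : ℕ → ℕ → ℕ → Set
IsLbal s t N = 1 ≤ N × GoodBalanced s t N × (∀ n → N < n → ¬ GoodBalanced s t n)

primesBelow : ℕ → ℕ
primesBelow p = length (filter prime? (upTo p))

IsNthPrime : ℕ → ℕ → Set
IsNthPrime m p = Prime p × suc (primesBelow p) ≡ m

-- Call a list L of integers a list of slots for a set X of positive integers if every
-- x ∈ X is divisible by some w ∈ L, where the slot 1 may only hold the integer 1.  Two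
-- coprime integers never share a slot, so X contains at most length L pairwise coprime
-- integers.  Let p be the (s+t-2)-th prime, so that k = s + t - 3 primes lie below p.
--
-- Upper bound: 1 and the k + 1 primes up to p are s + t - 1 pairwise coprime integers,
-- so on {1,…,n} with n ≥ p colour 0 contains s of them or colour 1 contains t of them.
--
-- Lower bound: p is odd, so n = p - 1 = 2h, and 1 together with the primes below p are
-- k + 1 slots for {1,…,n}.  Assuming t ≤ s, share them out as A = {1, odd primes},
-- B = {2} if t = 2, and otherwise as A = {the first s - 1 odd primes},
-- B = {1, 2, the remaining primes}, so that |A| = s - 1 and |B| = t - 1.  Each of A and
-- B is a list of slots for at least h of 1,…,n: B for the even ones, and A contains 3, 5
-- and, unless n = 6, 7, which divide 57 of every 105 consecutive integers (the cases
-- n < 111 are checked by evaluation).  Moving the integers that fit both A and B from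
-- one colour to the other one at a time then reaches a colouring with h integers of each
-- colour, colour 0 having slots A and colour 1 slots B.
module Submission where

open import Defs
open import Data.Nat using (ℕ; _≤_; _+_; _∸_)

open import Data.Bool using (Bool; true; false; not; T; if_then_else_; _∨_)
open import Data.Bool.Properties using (T-∨) renaming (_≟_ to _≟ᵇ_)
open import Data.Empty using (⊥-elim)
open import Data.Fin as Fin using (Fin; toℕ; fromℕ<; inject≤) renaming (_≟_ to _≟ᶠ_)
open import Data.Fin.Properties
  using (toℕ-injective; toℕ-fromℕ<; toℕ<n; injective⇒≤; inject≤-injective)
open import Data.List
  using (List; []; _∷_; [_]; _++_; _∷ʳ_; length; filter; tabulate; lookup; allFin; upTo; take; drop)
open import Data.List.Membership.Propositional using (_∈_; lose)
open import Data.List.Membership.Propositional.Properties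
  using (∈-lookup; ∈-filter⁺; ∈-filter⁻; ∈-upTo⁺; ∈-upTo⁻)
open import Data.List.Properties
  using (length-tabulate; length-++; length-take; length-drop; take++drop≡id; upTo-∷ʳ; filter-++; filter-accept)
open import Data.List.Relation.Unary.All as All using (All)
open import Data.List.Relation.Unary.All.Properties using (all-filter)
open import Data.List.Relation.Unary.AllPairs using (_∷_)
open import Data.List.Relation.Unary.Any as Any using (Any; any?; here; there)
open import Data.List.Relation.Unary.Any.Properties using (lookup-index; ++⁻)
open import Data.List.Relation.Unary.Unique.Propositional using (Unique)
open import Data.List.Relation.Unary.Unique.Propositional.Properties
  using (allFin⁺; upTo⁺) renaming (filter⁺ to unique-filter⁺)
open import Data.Nat
open import Data.Nat.Coprimality as Coprime using (Coprime; coprime⇒gcd≡1; 1-coprimeTo)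
open import Data.Nat.Divisibility
  using (_∣_; _∣?_; divides; ∣1⇒≡1; m∣m*n; ∣-refl; ∣⇒≤; ∣m∣n⇒∣m+n; ∣m+n∣m⇒∣n; m%n≡0⇒n∣m)
open import Data.Nat.DivMod using (_/_; _%_; m≡m%n+[m/n]*n; m%n<n)
open import Data.Nat.GCD using (gcd; gcd-greatest)
open import Data.Nat.Induction using (<-rec)
open import Data.Nat.ListAction using (product)
open import Data.Nat.Primality
  using (Prime; prime?; prime⇒irreducible; prime⇒nonZero; ¬prime[0]; ¬prime[1])
open import Data.Nat.Primality.Factorisation using (factorise)
open import Data.Nat.Properties
open import Data.Product using (Σ-syntax; _×_; _,_; proj₁; proj₂)
open import Data.Sum as Sum using (_⊎_; inj₁; inj₂)
open import Data.Unit using (tt)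
open import Function using (_∘_; id; case_of_)
open import Function.Bundles using (Equivalence)
open import Function.Definitions using (Injective)
open import Relation.Binary.PropositionalEquality
  using (_≡_; _≢_; refl; sym; trans; cong; cong₂; subst; subst₂; module ≡-Reasoning)
open import Relation.Nullary using (¬_; Dec; yes; no; does)
open import Relation.Nullary.Decidable
  using (_×-dec_; _→-dec_; ⌊_⌋; toWitness; fromWitness; toWitnessFalse; fromWitnessFalse)
open import Relation.Unary using (Pred; Decidable)

count : (ℕ → Bool) → ℕ → ℕ
count f zero    = 0
count f (suc n) = if f 0 then suc (count (f ∘ suc) n) else count (f ∘ suc) n

_⊆[_]_ : (ℕ → Bool) → ℕ → (ℕ → Bool) → Set
f ⊆[ n ] g = ∀ i → i < n → T (f i) → T (g i)

⊆-cons : ∀ {n f g} → (T (f 0) → T (g 0)) → (f ∘ suc) ⊆[ n ] (g ∘ suc) → f ⊆[ suc n ] g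
⊆-cons f₀⊆g₀ f⊆g zero    _         = f₀⊆g₀
⊆-cons f₀⊆g₀ f⊆g (suc i) (s≤s i<n) = f⊆g i i<n

⊆-tail : ∀ {n f g} → f ⊆[ suc n ] g → (f ∘ suc) ⊆[ n ] (g ∘ suc)
⊆-tail f⊆g i i<n = f⊆g (suc i) (s≤s i<n)

count-ext : ∀ n {f g} → (∀ i → f i ≡ g i) → count f n ≡ count g n
count-ext zero    f≗g = refl
count-ext (suc n) {f} {g} f≗g rewrite f≗g 0 =
  cong (λ c → if g 0 then suc c else c) (count-ext n (f≗g ∘ suc))

count-mono : ∀ n {f g} → f ⊆[ n ] g → count f n ≤ count g n
count-mono zero    _   = z≤n
count-mono (suc n) {f} {g} f⊆g with f 0 | g 0 | f⊆g 0 z<s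
... | true  | true  | _      = s≤s (count-mono n (⊆-tail f⊆g))
... | true  | false | f₀⇒g₀ = ⊥-elim (f₀⇒g₀ tt)
... | false | true  | _      = m≤n⇒m≤1+n (count-mono n (⊆-tail f⊆g))
... | false | false | _      = count-mono n (⊆-tail f⊆g)

count-not : ∀ n f → count f n + count (not ∘ f) n ≡ n
count-not zero    f = refl
count-not (suc n) f with f 0
... | true  = cong suc (count-not n (f ∘ suc))
... | false = trans (+-suc _ _) (cong suc (count-not n (f ∘ suc)))

count-+ : ∀ m n f → count f (m + n) ≡ count f m + count (f ∘ (m +_)) n
count-+ zero    n f = refl
count-+ (suc m) n f with f 0
... | true  = cong suc (count-+ m n (f ∘ suc))
... | false = count-+ m n (f ∘ suc)

_◂_ : Bool → (ℕ → Bool) → ℕ → Bool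
(b ◂ g) zero    = b
(b ◂ g) (suc i) = g i

intermediate-count : ∀ n {lo hi m} → lo ⊆[ n ] hi → count lo n ≤ m → m ≤ count hi n →
                     Σ[ g ∈ (ℕ → Bool) ] lo ⊆[ n ] g × g ⊆[ n ] hi × count g n ≡ m
intermediate-count zero {lo} lo⊆hi _ z≤n = lo , (λ _ _ → id) , lo⊆hi , refl
intermediate-count (suc n) {lo} {hi} {m} lo⊆hi lo≤m m≤hi
  with lo 0 in lo₀ | hi 0 in hi₀ | lo⊆hi 0 z<s
... | true  | false | lo₀⇒hi₀ = ⊥-elim (lo₀⇒hi₀ tt)
... | true  | true  | _ with s≤s lo≤m′ ← lo≤m | s≤s m′≤hi ← m≤hi
  with g , lo⊆g , g⊆hi , refl ← intermediate-count n (⊆-tail lo⊆hi) lo≤m′ m′≤hi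
  = true ◂ g , ⊆-cons (λ _ → tt) lo⊆g , ⊆-cons (λ _ → subst T (sym hi₀) tt) g⊆hi , refl
... | false | false | _
  with g , lo⊆g , g⊆hi , refl ← intermediate-count n (⊆-tail lo⊆hi) lo≤m m≤hi
  = false ◂ g , ⊆-cons (subst T lo₀) lo⊆g , ⊆-cons (λ ()) g⊆hi , refl
... | false | true  | _ with m ≤? count (hi ∘ suc) n
...   | yes m≤hi′
  with g , lo⊆g , g⊆hi , refl ← intermediate-count n (⊆-tail lo⊆hi) lo≤m m≤hi′
  = false ◂ g , ⊆-cons (subst T lo₀) lo⊆g , ⊆-cons (λ ()) g⊆hi , refl
...   | no m≰hi′ =
  -- now m = 1 + count (hi ∘ suc) n, so g may take all that hi allows
  true ◂ (hi ∘ suc) , ⊆-cons (λ _ → tt) (⊆-tail lo⊆hi) ,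
  ⊆-cons (λ _ → subst T (sym hi₀) tt) (λ _ _ → id) , ≤-antisym (≰⇒> m≰hi′) m≤hi

length-filter-tabulate : ∀ {a p} {A : Set a} {P : Pred A p} (P? : Decidable P) {n}
  (f : Fin n → A) (g : ℕ → Bool) → (∀ i → does (P? (f i)) ≡ g (toℕ i)) →
  length (filter P? (tabulate f)) ≡ count g n
length-filter-tabulate P? {zero}  f g agree = refl
length-filter-tabulate P? {suc n} f g agree with does (P? (f Fin.zero)) | g 0 | agree Fin.zero
... | true  | .true  | refl = cong suc (length-filter-tabulate P? (f ∘ Fin.suc) (g ∘ suc) (agree ∘ Fin.suc))
... | false | .false | refl = length-filter-tabulate P? (f ∘ Fin.suc) (g ∘ suc) (agree ∘ Fin.suc)

classSize-true : ∀ {n} (g : ℕ → Bool) → classSize {n} (g ∘ toℕ) true ≡ count g n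
classSize-true {n} g =
  length-filter-tabulate (λ i → g (toℕ i) ≟ᵇ true) {n} id g (λ i → does-≟true (g (toℕ i)))
  where
  does-≟true : ∀ b → does (b ≟ᵇ true) ≡ b
  does-≟true true  = refl
  does-≟true false = refl

classSize-false : ∀ {n} (g : ℕ → Bool) → classSize {n} (g ∘ toℕ) false ≡ count (not ∘ g) n
classSize-false {n} g =
  length-filter-tabulate (λ i → g (toℕ i) ≟ᵇ false) {n} id (not ∘ g) (λ i → does-≟false (g (toℕ i)))
  where
  does-≟false : ∀ b → does (b ≟ᵇ false) ≡ not b
  does-≟false true  = refl
  does-≟false false = refl

classSize-false+true : ∀ {n} (c : Colouring n) → classSize c false + classSize c true ≡ n
classSize-false+true {n} c = trans (split (allFin n)) (length-tabulate id)
  where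
  split : ∀ xs → length (filter (λ i → c i ≟ᵇ false) xs) + length (filter (λ i → c i ≟ᵇ true) xs)
                 ≡ length xs
  split []       = refl
  split (x ∷ xs) with c x
  ... | false = cong suc (split xs)
  ... | true  = trans (+-suc _ _) (cong suc (split xs))

*2≡+ : ∀ h → h * 2 ≡ h + h
*2≡+ h = trans (*-comm h 2) (cong (h +_) (+-identityʳ h))

half-complement : ∀ {h x y} → x + y ≡ h * 2 → h ≤ x → y ≤ h
half-complement {h} {x} {y} x+y≡2h h≤x = +-cancelˡ-≤ h y h (begin
  h + y  ≤⟨ +-monoˡ-≤ y h≤x ⟩
  x + y  ≡⟨ trans x+y≡2h (*2≡+ h) ⟩
  h + h  ∎)
  where open ≤-Reasoning

count≡half⇒Balanced : ∀ {h} (g : ℕ → Bool) → count g (h * 2) ≡ h → Balanced {h * 2} (g ∘ toℕ)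
count≡half⇒Balanced {h} g #g≡h =
  subst₂ (λ x y → x ≤ suc y) (sym #false≡h) (sym #true≡h) (n≤1+n h) ,
  subst₂ (λ x y → x ≤ suc y) (sym #true≡h) (sym #false≡h) (n≤1+n h)
  where
  open ≡-Reasoning
  n : ℕ
  n = h * 2

  #true≡h : classSize {n} (g ∘ toℕ) true ≡ h
  #true≡h = trans (classSize-true {n} g) #g≡h

  #false≡h : classSize {n} (g ∘ toℕ) false ≡ h
  #false≡h = trans (classSize-false {n} g) (+-cancelˡ-≡ h _ _ (begin
    h + count (not ∘ g) n         ≡⟨ cong (_+ count (not ∘ g) n) (sym #g≡h) ⟩
    count g n + count (not ∘ g) n ≡⟨ count-not n g ⟩
    h * 2                         ≡⟨ *2≡+ h ⟩
    h + h                         ∎))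

-- Slots

_covers_ : ℕ → ℕ → Set
w covers v = w ∣ v × (w ≡ 1 → v ≡ 1)

covers? : ∀ w v → Dec (w covers v)
covers? w v = w ∣? v ×-dec (w ≟ 1 →-dec v ≟ 1)

Covered : List ℕ → ℕ → Set
Covered L v = Any (_covers v) L

covered? : ∀ L v → Dec (Covered L v)
covered? L v = any? (λ w → covers? w v) L

#covered : List ℕ → ℕ → ℕ
#covered L = count (λ i → ⌊ covered? L (suc i) ⌋)

∣⇒covers : ∀ {w v} → w ≢ 1 → w ∣ v → w covers v
∣⇒covers w≢1 w∣v = w∣v , ⊥-elim ∘ w≢1

1-covers-1 : 1 covers 1
1-covers-1 = ∣-refl , λ _ → refl

covers-coprime⇒≡ : ∀ {w u v} → w covers u → w covers v → gcd u v ≡ 1 → u ≡ v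
covers-coprime⇒≡ (w∣u , w≡1⇒u≡1) (w∣v , w≡1⇒v≡1) gcd≡1 =
  trans (w≡1⇒u≡1 w≡1) (sym (w≡1⇒v≡1 w≡1))
  where
  w≡1 : _ ≡ 1
  w≡1 = ∣1⇒≡1 (subst (_ ∣_) gcd≡1 (gcd-greatest w∣u w∣v))

val-injective : ∀ {n} {i j : Fin n} → val i ≡ val j → i ≡ j
val-injective = toℕ-injective ∘ suc-injective

cover⇒¬HasCoprimeSet : ∀ {n} {c : Colouring n} {b k} (L : List ℕ) →
  (∀ i → c i ≡ b → Covered L (val i)) → length L < k → ¬ HasCoprimeSet c b k
cover⇒¬HasCoprimeSet {k = k} L covered |L|<k (f , f-injective , f-colour , f-coprime) =
  <⇒≱ |L|<k (injective⇒≤ slot-injective)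
  where
  slotOf : ∀ i → Covered L (val (f i))
  slotOf i = covered (f i) (f-colour i)

  slot : Fin k → Fin (length L)
  slot = Any.index ∘ slotOf

  slot-injective : Injective _≡_ _≡_ slot
  slot-injective {i} {j} same with i ≟ᶠ j
  ... | yes i≡j = i≡j
  ... | no  i≢j = ⊥-elim (i≢j (f-injective (val-injective
        (covers-coprime⇒≡ (lookup-index (slotOf i))
          (subst (λ x → lookup L x covers _) (sym same) (lookup-index (slotOf j)))
          (f-coprime i j i≢j)))))

-- The lower-bound colouring

-- A and B are to be slots for colour 0 and colour 1 respectively
record BalancedCover (s t h : ℕ) : Set where
  field
    A B     : List ℕ
    A-short : length A < s
    B-short : length B < t
    A∪B     : ∀ {v} → 1 ≤ v → v ≤ h * 2 → Covered A v ⊎ Covered B v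
    A-half  : h ≤ #covered A (h * 2)
    B-half  : h ≤ #covered B (h * 2)

BalancedCover-swap : ∀ {s t h} → BalancedCover s t h → BalancedCover t s h
BalancedCover-swap cover = record
  { A = B ; B = A ; A-short = B-short ; B-short = A-short
  ; A∪B = λ 1≤v v≤2h → Sum.swap (A∪B 1≤v v≤2h) ; A-half = B-half ; B-half = A-half }
  where open BalancedCover cover

BalancedCover⇒GoodBalanced : ∀ {s t h} → BalancedCover s t h → GoodBalanced s t (h * 2)
BalancedCover⇒GoodBalanced {s} {t} {h} cover =
  colouring (intermediate-count n outA⊆inB (half-complement (count-not n inA) A-half) B-half)
  where
  open BalancedCover cover
  n : ℕ
  n = h * 2

  inA inB : ℕ → Bool
  inA i = ⌊ covered? A (suc i) ⌋
  inB i = ⌊ covered? B (suc i) ⌋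

  outA⊆inB : (not ∘ inA) ⊆[ n ] inB
  outA⊆inB i i<n outA with A∪B (s≤s z≤n) i<n
  ... | inj₁ inA = ⊥-elim (toWitnessFalse outA inA)
  ... | inj₂ inB = fromWitness inB

  colouring : Σ[ g ∈ (ℕ → Bool) ] (not ∘ inA) ⊆[ n ] g × g ⊆[ n ] inB × count g n ≡ h →
              GoodBalanced s t n
  colouring (g , outA⊆g , g⊆inB , #g≡h) =
    c , count≡half⇒Balanced g #g≡h ,
    cover⇒¬HasCoprimeSet A A-colour A-short , cover⇒¬HasCoprimeSet B B-colour B-short
    where
    c : Colouring n
    c = g ∘ toℕ

    A-colour : ∀ i → c i ≡ false → Covered A (val i)
    A-colour i cᵢ≡false with covered? A (val i)
    ... | yes inA  = inA
    ... | no  outA = ⊥-elim (subst T cᵢ≡false (outA⊆g (toℕ i) (toℕ<n i) (fromWitnessFalse outA)))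

    B-colour : ∀ i → c i ≡ true → Covered B (val i)
    B-colour i cᵢ≡true = toWitness (g⊆inB (toℕ i) (toℕ<n i) (subst T (sym cᵢ≡true) tt))

-- The upper bound

lookup-injective : ∀ {a} {A : Set a} {xs : List A} → Unique xs →
                   ∀ i j → lookup xs i ≡ lookup xs j → i ≡ j
lookup-injective (_   ∷ _) Fin.zero    Fin.zero    _  = refl
lookup-injective (x∉ ∷ _) Fin.zero    (Fin.suc j) eq = ⊥-elim (All.lookup x∉ (∈-lookup j) eq)
lookup-injective (x∉ ∷ _) (Fin.suc i) Fin.zero    eq = ⊥-elim (All.lookup x∉ (∈-lookup i) (sym eq))
lookup-injective (_   ∷ u) (Fin.suc i) (Fin.suc j) eq = cong Fin.suc (lookup-injective u i j eq)

colourClass-enumeration : ∀ {n} (c : Colouring n) b {j} → j ≤ classSize c b →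
  Σ[ f ∈ (Fin j → Fin n) ] Injective _≡_ _≡_ f × (∀ i → c (f i) ≡ b)
colourClass-enumeration {n} c b j≤ = f , f-injective , f-colour
  where
  f : Fin _ → Fin n
  f = lookup (filter (λ i → c i ≟ᵇ b) (allFin n)) ∘ (λ i → inject≤ i j≤)

  f-injective : Injective _≡_ _≡_ f
  f-injective {i} {j} eq = inject≤-injective j≤ j≤ i j
    (lookup-injective (unique-filter⁺ (λ i → c i ≟ᵇ b) (allFin⁺ n)) _ _ eq)

  f-colour : ∀ i → c (f i) ≡ b
  f-colour i = All.lookup (all-filter (λ i → c i ≟ᵇ b) (allFin n)) (∈-lookup _)

pigeonhole₂ : ∀ {s t x y} → s + t ≤ suc (x + y) → s ≤ x ⊎ t ≤ y
pigeonhole₂ {s} {t} {x} {y} s+t≤ with s ≤? x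
... | yes s≤x = inj₁ s≤x
... | no  s≰x = inj₂ (+-cancelˡ-≤ s t y (≤-trans s+t≤ (+-monoˡ-≤ y (≰⇒> s≰x))))

coprimeEmbedding⇒HasCoprimeSet : ∀ {m n s t} (e : Fin m → Fin n) → Injective _≡_ _≡_ e →
  (∀ i j → i ≢ j → gcd (val (e i)) (val (e j)) ≡ 1) → s + t ≤ suc m →
  (c : Colouring n) → HasCoprimeSet c false s ⊎ HasCoprimeSet c true t
coprimeEmbedding⇒HasCoprimeSet {m} e e-injective e-coprime s+t≤ c =
  Sum.map (along ∘ colourClass-enumeration (c ∘ e) false)
          (along ∘ colourClass-enumeration (c ∘ e) true)
          (pigeonhole₂ (subst (λ x → _ ≤ suc x) (sym (classSize-false+true (c ∘ e))) s+t≤))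
  where
  along : ∀ {b k} → Σ[ f ∈ (Fin k → Fin m) ] Injective _≡_ _≡_ f × (∀ i → c (e (f i)) ≡ b) →
          HasCoprimeSet c b k
  along (f , f-injective , f-colour) =
    e ∘ f , f-injective ∘ e-injective , f-colour ,
    λ i j i≢j → e-coprime (f i) (f j) (i≢j ∘ f-injective)

val-surjective : ∀ {n v} → 1 ≤ v → v ≤ n → Σ[ i ∈ Fin n ] val i ≡ v
val-surjective {v = suc u} _ u<n = fromℕ< u<n , cong suc (toℕ-fromℕ< u<n)

coprimeList⇒HasCoprimeSet : ∀ {n s t} (V : List ℕ) → Unique V →
  (∀ {v} → v ∈ V → 1 ≤ v × v ≤ n) → (∀ {v w} → v ∈ V → w ∈ V → v ≢ w → gcd v w ≡ 1) →
  s + t ≤ suc (length V) → (c : Colouring n) → HasCoprimeSet c false s ⊎ HasCoprimeSet c true t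
coprimeList⇒HasCoprimeSet {n} V V-unique V-range V-coprime =
  coprimeEmbedding⇒HasCoprimeSet e e-injective e-coprime
  where
  embedding : ∀ i → Σ[ j ∈ Fin n ] val j ≡ lookup V i
  embedding i = let (1≤v , v≤n) = V-range (∈-lookup i) in val-surjective 1≤v v≤n

  e : Fin (length V) → Fin n
  e = proj₁ ∘ embedding

  e-injective : Injective _≡_ _≡_ e
  e-injective {i} {j} eq = lookup-injective V-unique i j
    (trans (sym (proj₂ (embedding i))) (trans (cong val eq) (proj₂ (embedding j))))

  e-coprime : ∀ i j → i ≢ j → gcd (val (e i)) (val (e j)) ≡ 1
  e-coprime i j i≢j =
    subst₂ (λ v w → gcd v w ≡ 1) (sym (proj₂ (embedding i))) (sym (proj₂ (embedding j)))
      (V-coprime (∈-lookup i) (∈-lookup j) (i≢j ∘ lookup-injective V-unique i j))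

unitOrPrime-coprime : ∀ {v w} → v ≡ 1 ⊎ Prime v → w ≡ 1 ⊎ Prime w → v ≢ w → gcd v w ≡ 1
unitOrPrime-coprime {w = w} (inj₁ refl) _ _ = coprime⇒gcd≡1 (1-coprimeTo w)
unitOrPrime-coprime {v} (inj₂ _) (inj₁ refl) _ = coprime⇒gcd≡1 (Coprime.sym (1-coprimeTo v))
unitOrPrime-coprime {v} {w} (inj₂ v-prime) (inj₂ w-prime) v≢w = coprime⇒gcd≡1 coprime
  where
  coprime : Coprime v w
  coprime (d∣v , d∣w) with prime⇒irreducible v-prime d∣v
  ... | inj₁ d≡1 = d≡1
  ... | inj₂ refl with prime⇒irreducible w-prime d∣w
  ...   | inj₁ refl = ⊥-elim (¬prime[1] v-prime)
  ...   | inj₂ v≡w  = ⊥-elim (v≢w v≡w)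

primeFactor : ∀ {v} → 2 ≤ v → Σ[ q ∈ ℕ ] Prime q × q ∣ v
primeFactor {v@(suc _)} 2≤v with factorise v
... | record { factors = [] ; isFactorisation = v≡1 } = ⊥-elim (<⇒≢ 2≤v (sym v≡1))
... | record { factors = q ∷ qs ; isFactorisation = v≡q*qs ; factorsPrime = q-prime All.∷ _ } =
  q , q-prime , subst (q ∣_) (sym v≡q*qs) (m∣m*n (product qs))

oneAndPrimesUpTo : ℕ → List ℕ
oneAndPrimesUpTo p = 1 ∷ filter prime? (upTo (suc p))

∈-oneAndPrimesUpTo⁻ : ∀ {p v} → 1 ≤ p → v ∈ oneAndPrimesUpTo p →
                      (v ≡ 1 ⊎ Prime v) × 1 ≤ v × v ≤ p
∈-oneAndPrimesUpTo⁻ 1≤p (here refl) = inj₁ refl , ≤-refl , 1≤p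
∈-oneAndPrimesUpTo⁻ {v = v} 1≤p (there v∈) =
  let (v<1+p , v-prime) = ∈-filter⁻ prime? v∈
  in inj₂ v-prime , >-nonZero⁻¹ v {{prime⇒nonZero v-prime}} , ≤-pred (∈-upTo⁻ v<1+p)

oneAndPrimesUpTo-unique : ∀ p → Unique (oneAndPrimesUpTo p)
oneAndPrimesUpTo-unique p = All.map 1≢prime (all-filter prime? (upTo (suc p)))
                          ∷ unique-filter⁺ prime? (upTo⁺ (suc p))
  where
  1≢prime : ∀ {v} → Prime v → 1 ≢ v
  1≢prime v-prime refl = ¬prime[1] v-prime

length-oneAndPrimesUpTo : ∀ {p} → Prime p → length (oneAndPrimesUpTo p) ≡ 2 + primesBelow p
length-oneAndPrimesUpTo {p} p-prime = cong suc (begin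
  length (filter prime? (upTo (suc p)))                  ≡⟨ cong (length ∘ filter prime?) (sym (upTo-∷ʳ p)) ⟩
  length (filter prime? (upTo p ∷ʳ p))                   ≡⟨ cong length (filter-++ prime? (upTo p) [ p ]) ⟩
  length (filter prime? (upTo p) ++ filter prime? [ p ]) ≡⟨ length-++ (filter prime? (upTo p)) ⟩
  primesBelow p + length (filter prime? [ p ])           ≡⟨ cong (λ xs → primesBelow p + length xs)
                                                                 (filter-accept prime? p-prime) ⟩
  primesBelow p + 1                                      ≡⟨ +-comm _ 1 ⟩
  suc (primesBelow p)                                    ∎)
  where open ≡-Reasoning

-- drop 1 removes the prime 2
oddPrimesBelow : ℕ → List ℕ
oddPrimesBelow p = drop 1 (filter prime? (upTo p))

suc-length-oddPrimesBelow : ∀ {p} → 3 ≤ p → suc (length (oddPrimesBelow p)) ≡ primesBelow p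
suc-length-oddPrimesBelow (s≤s (s≤s (s≤s _))) = refl

3≤length-oddPrimesBelow : ∀ {p} → 8 ≤ p → 3 ≤ length (oddPrimesBelow p)
3≤length-oddPrimesBelow (s≤s (s≤s (s≤s (s≤s (s≤s (s≤s (s≤s (s≤s _)))))))) = s≤s (s≤s (s≤s z≤n))

∈-oddPrimesBelow⁺ : ∀ {p q} → 3 ≤ p → Prime q → q ≢ 2 → q < p → q ∈ oddPrimesBelow p
∈-oddPrimesBelow⁺ (s≤s (s≤s (s≤s _))) q-prime q≢2 q<p with ∈-filter⁺ prime? (∈-upTo⁺ q<p) q-prime
... | here q≡2 = ⊥-elim (q≢2 q≡2)
... | there q∈ = q∈

-- the first odd primes are found by evaluating oddPrimesBelow
3/5/7∈take-oddPrimesBelow : ∀ {p j} → 7 ≤ p → 2 ≤ j → (8 ≤ p → 3 ≤ j) →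
  let A = take j (oddPrimesBelow p) in 3 ∈ A × 5 ∈ A × (7 ∈ A ⊎ p ≤ 7)
3/5/7∈take-oddPrimesBelow 7≤p 2≤j 8≤p⇒3≤j with m≤n⇒m<n∨m≡n 7≤p | 2≤j
... | inj₂ refl | s≤s (s≤s _) = here refl , there (here refl) , inj₂ ≤-refl
... | inj₁ 8≤p  | _ with 8≤p | 8≤p⇒3≤j 8≤p
...   | s≤s (s≤s (s≤s (s≤s (s≤s (s≤s (s≤s (s≤s _))))))) | s≤s (s≤s (s≤s _)) =
  here refl , there (here refl) , inj₁ (there (there (here refl)))

1≤primesBelow⇒3≤p : ∀ {p} → Prime p → 1 ≤ primesBelow p → 3 ≤ p
1≤primesBelow⇒3≤p {0}                 0-prime _ = ⊥-elim (¬prime[0] 0-prime)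
1≤primesBelow⇒3≤p {1}                 1-prime _ = ⊥-elim (¬prime[1] 1-prime)
1≤primesBelow⇒3≤p {2}                 _       ()
1≤primesBelow⇒3≤p {suc (suc (suc _))} _       _ = s≤s (s≤s (s≤s z≤n))

primesBelow<3 : ∀ {p} → p < 7 → Prime p → primesBelow p < 3
primesBelow<3 = toWitness {a? = allUpTo? (λ p → prime? p →-dec primesBelow p <? 3) 7} tt

3≤primesBelow⇒7≤p : ∀ {p} → Prime p → 3 ≤ primesBelow p → 7 ≤ p
3≤primesBelow⇒7≤p {p} p-prime 3≤k with p <? 7
... | yes p<7 = ⊥-elim (<⇒≱ (primesBelow<3 p<7 p-prime) 3≤k)
... | no  p≮7 = ≮⇒≥ p≮7

oddPrime≡1+2h : ∀ {p} → Prime p → 3 ≤ p → p ≡ suc (p / 2 * 2)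
oddPrime≡1+2h {p} p-prime 3≤p = trans (m≡m%n+[m/n]*n p 2) (cong (_+ p / 2 * 2) p%2≡1)
  where
  2∤p : ¬ 2 ∣ p
  2∤p 2∣p with prime⇒irreducible p-prime 2∣p
  ... | inj₁ ()
  ... | inj₂ 2≡p = <⇒≱ (n<1+n 2) (subst (3 ≤_) (sym 2≡p) 3≤p)

  p%2≡1 : p % 2 ≡ 1
  p%2≡1 with p % 2 in p%2≡ | m%n<n p 2
  ... | 0           | _ = ⊥-elim (2∤p (m%n≡0⇒n∣m p 2 p%2≡))
  ... | 1           | _ = refl
  ... | suc (suc _) | s≤s (s≤s ())

-- Parity and multiples of 3, 5 and 7

∣?-shift : ∀ d {m} v → d ∣ m → ⌊ d ∣? (m + v) ⌋ ≡ ⌊ d ∣? v ⌋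
∣?-shift d {m} v d∣m with d ∣? (m + v) | d ∣? v
... | yes _     | yes _   = refl
... | no  _     | no  _   = refl
... | yes d∣m+v | no  d∤v = ⊥-elim (d∤v (∣m+n∣m⇒∣n d∣m+v d∣m))
... | no  d∤m+v | yes d∣v = ⊥-elim (d∤m+v (∣m∣n⇒∣m+n d∣m d∣v))

#even : ∀ h → count (λ i → ⌊ 2 ∣? suc i ⌋) (h * 2) ≡ h
#even zero    = refl
#even (suc h) =
  cong suc (trans (count-ext (h * 2) (λ i → ∣?-shift 2 {2} (suc i) (divides 1 refl))) (#even h))

#odd : ∀ h → count (λ i → not ⌊ 2 ∣? suc i ⌋) (h * 2) ≡ h
#odd h = +-cancelˡ-≡ h _ _ (begin
  h + #odds             ≡⟨ cong (_+ #odds) (sym (#even h)) ⟩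
  #evens + #odds        ≡⟨ count-not (h * 2) _ ⟩
  h * 2                 ≡⟨ *2≡+ h ⟩
  h + h                 ∎)
  where
  open ≡-Reasoning
  #evens #odds : ℕ
  #evens = count (λ i → ⌊ 2 ∣? suc i ⌋) (h * 2)
  #odds  = count (λ i → not ⌊ 2 ∣? suc i ⌋) (h * 2)

even⇒covered : ∀ {L v} → 2 ∈ L → 2 ∣ v → Covered L v
even⇒covered 2∈L 2∣v = lose 2∈L (∣⇒covers (λ ()) 2∣v)

odd⇒covered : ∀ {p v} → 3 ≤ p → 2 ≤ v → v < p → ¬ 2 ∣ v → Covered (oddPrimesBelow p) v
odd⇒covered {v = suc _} 3≤p 2≤v v<p 2∤v with primeFactor 2≤v
... | q , q-prime , q∣v =
  lose (∈-oddPrimesBelow⁺ 3≤p q-prime q≢2 (≤-<-trans (∣⇒≤ q∣v) v<p)) (∣⇒covers q≢1 q∣v)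
  where
  q≢2 : q ≢ 2
  q≢2 refl = 2∤v q∣v
  q≢1 : q ≢ 1
  q≢1 refl = ¬prime[1] q-prime

2∈⇒half-covered : ∀ {L} h → 2 ∈ L → h ≤ #covered L (h * 2)
2∈⇒half-covered h 2∈L = ≤-trans (≤-reflexive (sym (#even h)))
  (count-mono (h * 2) (λ i _ 2∣v → fromWitness (even⇒covered 2∈L (toWitness 2∣v))))

divisibleBy3/5/7 : ℕ → Bool
divisibleBy3/5/7 v = ⌊ 3 ∣? v ⌋ ∨ ⌊ 5 ∣? v ⌋ ∨ ⌊ 7 ∣? v ⌋

#divisibleBy3/5/7 : ℕ → ℕ
#divisibleBy3/5/7 = count (divisibleBy3/5/7 ∘ suc)

#divisibleBy3/5/7-+105 : ∀ n → #divisibleBy3/5/7 (105 + n) ≡ 57 + #divisibleBy3/5/7 n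
#divisibleBy3/5/7-+105 n =
  trans (count-+ 105 n (divisibleBy3/5/7 ∘ suc)) (cong (57 +_) (count-ext n (periodic ∘ suc)))
  where
  -- m = 105 is explicit: inferred from divides 35 refl it would be 35 * 3, and comparing
  -- that with 105 makes the type checker evaluate divisibility of open terms.
  periodic : ∀ v → divisibleBy3/5/7 (105 + v) ≡ divisibleBy3/5/7 v
  periodic v = cong₂ _∨_ (∣?-shift 3 {105} v (divides 35 refl))
              (cong₂ _∨_ (∣?-shift 5 {105} v (divides 21 refl)) (∣?-shift 7 {105} v (divides 15 refl)))

divisibleBy3/5/7-half : ∀ n → 6 ≤ n → n ≤ #divisibleBy3/5/7 n * 2
divisibleBy3/5/7-half = <-rec (λ n → 6 ≤ n → n ≤ #divisibleBy3/5/7 n * 2) step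
  where
  below111 : ∀ {n} → n < 111 → 6 ≤ n → n ≤ #divisibleBy3/5/7 n * 2
  below111 = toWitness {a? = allUpTo? (λ n → 6 ≤? n →-dec n ≤? #divisibleBy3/5/7 n * 2) 111} tt

  step : ∀ n → (∀ {m} → m < n → 6 ≤ m → m ≤ #divisibleBy3/5/7 m * 2) →
         6 ≤ n → n ≤ #divisibleBy3/5/7 n * 2
  step n rec 6≤n with n <? 111
  ... | yes n<111 = below111 n<111 6≤n
  ... | no  n≮111 = subst (λ x → x ≤ #divisibleBy3/5/7 x * 2) (m+[n∸m]≡n 105≤n) (begin
    105 + m                          ≤⟨ +-mono-≤ (m≤m+n 105 9) (rec m<n 6≤m) ⟩
    114 + #divisibleBy3/5/7 m * 2    ≡⟨ sym period ⟩
    #divisibleBy3/5/7 (105 + m) * 2  ∎)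
    where
    open ≤-Reasoning
    m : ℕ
    m = n ∸ 105
    111≤n : 111 ≤ n
    111≤n = ≮⇒≥ n≮111
    105≤n : 105 ≤ n
    105≤n = ≤-trans (m≤m+n 105 6) 111≤n
    6≤m : 6 ≤ m
    6≤m = ∸-monoˡ-≤ 105 111≤n
    m<n : m < n
    m<n = ∸-monoʳ-< {o = 0} z<s 105≤n
    period : #divisibleBy3/5/7 (105 + m) * 2 ≡ 114 + #divisibleBy3/5/7 m * 2
    period = trans (cong (_* 2) {#divisibleBy3/5/7 (105 + m)} (#divisibleBy3/5/7-+105 m))
                   (*-distribʳ-+ 2 57 (#divisibleBy3/5/7 m))

divisibleBy3/5/7⇒covered : ∀ {A v} → 3 ∈ A → 5 ∈ A → 7 ∈ A ⊎ v < 7 → 1 ≤ v →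
  T (divisibleBy3/5/7 v) → Covered A v
divisibleBy3/5/7⇒covered {v = v@(suc _)} 3∈A 5∈A 7∈A⊎v<7 _ divisible
  with Equivalence.to (T-∨ {⌊ 3 ∣? v ⌋}) divisible
... | inj₁ 3∣v = lose 3∈A (∣⇒covers (λ ()) (toWitness 3∣v))
... | inj₂ divisible′ with Equivalence.to (T-∨ {⌊ 5 ∣? v ⌋}) divisible′ | 7∈A⊎v<7
...   | inj₁ 5∣v | _        = lose 5∈A (∣⇒covers (λ ()) (toWitness 5∣v))
...   | inj₂ 7∣v | inj₁ 7∈A = lose 7∈A (∣⇒covers (λ ()) (toWitness 7∣v))
...   | inj₂ 7∣v | inj₂ v<7 = ⊥-elim (<⇒≱ v<7 (∣⇒≤ (toWitness 7∣v)))

3/5/7∈⇒half-covered : ∀ {A h} → 3 ∈ A → 5 ∈ A → 7 ∈ A ⊎ h * 2 < 7 → 3 ≤ h →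
                      h ≤ #covered A (h * 2)
3/5/7∈⇒half-covered {h = h} 3∈A 5∈A 7∈A⊎2h<7 3≤h =
  ≤-trans half (count-mono (h * 2) λ i i<2h divisible → fromWitness
    (divisibleBy3/5/7⇒covered 3∈A 5∈A (Sum.map₂ (≤-<-trans i<2h) 7∈A⊎2h<7) (s≤s z≤n) divisible))
  where
  half : h ≤ #divisibleBy3/5/7 (h * 2)
  half = *-cancelʳ-≤ h _ 2 (divisibleBy3/5/7-half (h * 2) (*-monoˡ-≤ 2 3≤h))

-- Sharing out the slots below an odd p = 2h + 1

module _ {p h} (3≤p : 3 ≤ p) (p≡1+2h : p ≡ suc (h * 2)) where

  private
    odd⇒one⊎covered : ∀ {v} → 1 ≤ v → v ≤ h * 2 → ¬ 2 ∣ v → v ≡ 1 ⊎ Covered (oddPrimesBelow p) v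
    odd⇒one⊎covered {1}           _ _    _   = inj₁ refl
    odd⇒one⊎covered {suc (suc _)} _ v≤2h 2∤v =
      inj₂ (odd⇒covered 3≤p (s≤s (s≤s z≤n)) (subst (_ <_) (sym p≡1+2h) (s≤s v≤2h)) 2∤v)

  parityCover : BalancedCover (2 + length (oddPrimesBelow p)) 2 h
  parityCover = record
    { A = 1 ∷ oddPrimesBelow p
    ; B = 2 ∷ []
    ; A-short = ≤-refl
    ; B-short = ≤-refl
    ; A∪B = λ {v} 1≤v v≤2h → case 2 ∣? v of λ where
        (yes 2∣v) → inj₂ (even⇒covered (here refl) 2∣v)
        (no 2∤v)  → inj₁ (odd⇒coveredA 1≤v v≤2h 2∤v)
    ; A-half = ≤-trans (≤-reflexive (sym (#odd h))) (count-mono (h * 2) λ i i<2h odd →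
        fromWitness (odd⇒coveredA (s≤s z≤n) i<2h (toWitnessFalse odd)))
    ; B-half = 2∈⇒half-covered h (here refl)
    }
    where
    odd⇒coveredA : ∀ {v} → 1 ≤ v → v ≤ h * 2 → ¬ 2 ∣ v → Covered (1 ∷ oddPrimesBelow p) v
    odd⇒coveredA 1≤v v≤2h 2∤v with odd⇒one⊎covered 1≤v v≤2h 2∤v
    ... | inj₁ refl = here 1-covers-1
    ... | inj₂ q∣v  = there q∣v

  splitCover : ∀ j t′ → length (oddPrimesBelow p) ≡ j + t′ →
    h ≤ #covered (take j (oddPrimesBelow p)) (h * 2) → BalancedCover (suc j) (3 + t′) h
  splitCover j t′ |Q|≡j+t′ A-half = record
    { A = take j Q
    ; B = 1 ∷ 2 ∷ drop j Q
    ; A-short = s≤s (≤-trans (≤-reflexive (length-take j Q)) (m⊓n≤m j _))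
    ; B-short = s≤s (s≤s (s≤s (≤-reflexive (trans (length-drop j Q)
                  (trans (cong (_∸ j) |Q|≡j+t′) (m+n∸m≡n j t′))))))
    ; A∪B = λ {v} 1≤v v≤2h → case 2 ∣? v of λ where
        (yes 2∣v) → inj₂ (even⇒covered (there (here refl)) 2∣v)
        (no 2∤v)  → case odd⇒one⊎covered 1≤v v≤2h 2∤v of λ where
          (inj₁ refl) → inj₂ (here 1-covers-1)
          (inj₂ q∣v)  → Sum.map₂ (there ∘ there)
                          (++⁻ (take j Q) (subst (Any _) (sym (take++drop≡id j Q)) q∣v))
    ; A-half = A-half
    ; B-half = 2∈⇒half-covered h (there (here refl))
    }
    where
    Q : List ℕ
    Q = oddPrimesBelow p

firstOddPrimes-half : ∀ {p h j t′} → Prime p → 3 ≤ p → p ≡ suc (h * 2) →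
  length (oddPrimesBelow p) ≡ j + t′ → 2 + t′ ≤ j → h ≤ #covered (take j (oddPrimesBelow p)) (h * 2)
firstOddPrimes-half {p} {h} {j} {t′} p-prime 3≤p p≡1+2h q≡j+t′ 2+t′≤j =
  let (3∈A , 5∈A , 7∈A⊎p≤7) = 3/5/7∈take-oddPrimesBelow 7≤p 2≤j 8≤p⇒3≤j
  in 3/5/7∈⇒half-covered 3∈A 5∈A (Sum.map₂ (subst (_≤ 7) p≡1+2h) 7∈A⊎p≤7) 3≤h
  where
  2≤j : 2 ≤ j
  2≤j = ≤-trans (m≤m+n 2 t′) 2+t′≤j

  7≤p : 7 ≤ p
  7≤p = 3≤primesBelow⇒7≤p p-prime (subst (3 ≤_) (suc-length-oddPrimesBelow 3≤p)
          (s≤s (≤-trans 2≤j (≤-trans (m≤m+n j t′) (≤-reflexive (sym q≡j+t′))))))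

  8≤p⇒3≤j : 8 ≤ p → 3 ≤ j
  8≤p⇒3≤j 8≤p = 3≤j 2+t′≤j (subst (3 ≤_) q≡j+t′ (3≤length-oddPrimesBelow 8≤p))
    where
    3≤j : ∀ {u} → 2 + u ≤ j → 3 ≤ j + u → 3 ≤ j
    3≤j {zero}  _      3≤j+0 = subst (3 ≤_) (+-identityʳ j) 3≤j+0
    3≤j {suc _} 2+u≤j _      = ≤-trans (s≤s (s≤s (s≤s z≤n))) 2+u≤j

  3≤h : 3 ≤ h
  3≤h = *-cancelʳ-≤ 3 h 2 (≤-pred (subst (7 ≤_) p≡1+2h 7≤p))

balancedCover≥ : ∀ {p h} s t → Prime p → 3 ≤ p → p ≡ suc (h * 2) → 2 ≤ t → t ≤ s →
  primesBelow p + 3 ≡ s + t → BalancedCover s t h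
balancedCover≥ _ 0 _ _ _ () _ _
balancedCover≥ _ 1 _ _ _ (s≤s ()) _ _
balancedCover≥ {p} {h} s 2 _ 3≤p p≡1+2h _ _ k+3≡s+2 =
  subst (λ s → BalancedCover s 2 h) (+-cancelʳ-≡ 2 _ _ (begin
    2 + q + 2          ≡⟨ cong suc (sym (+-suc q 2)) ⟩
    suc q + 3          ≡⟨ cong (_+ 3) (suc-length-oddPrimesBelow 3≤p) ⟩
    primesBelow p + 3  ≡⟨ k+3≡s+2 ⟩
    s + 2              ∎))
    (parityCover 3≤p p≡1+2h)
  where
  open ≡-Reasoning
  q : ℕ
  q = length (oddPrimesBelow p)
balancedCover≥ zero (suc (suc (suc _))) _ _ _ _ () _
balancedCover≥ {p} (suc j) (suc (suc (suc t′))) p-prime 3≤p p≡1+2h _ (s≤s 2+t′≤j) k+3≡s+t =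
  splitCover 3≤p p≡1+2h j t′ q≡j+t′ (firstOddPrimes-half p-prime 3≤p p≡1+2h q≡j+t′ 2+t′≤j)
  where
  open ≡-Reasoning
  q : ℕ
  q = length (oddPrimesBelow p)

  q≡j+t′ : q ≡ j + t′
  q≡j+t′ = +-cancelʳ-≡ 3 _ _ (begin
    q + 3         ≡⟨ suc-injective (trans (cong (_+ 3) (suc-length-oddPrimesBelow 3≤p)) k+3≡s+t) ⟩
    j + (3 + t′)  ≡⟨ cong (j +_) (+-comm 3 t′) ⟩
    j + (t′ + 3)  ≡⟨ sym (+-assoc j t′ 3) ⟩
    j + t′ + 3    ∎)

balancedCover : ∀ {p h} s t → Prime p → 3 ≤ p → p ≡ suc (h * 2) → 2 ≤ s → 2 ≤ t →
  primesBelow p + 3 ≡ s + t → BalancedCover s t h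
balancedCover s t p-prime 3≤p p≡1+2h 2≤s 2≤t k+3≡s+t with ≤-total t s
... | inj₁ t≤s = balancedCover≥ s t p-prime 3≤p p≡1+2h 2≤t t≤s k+3≡s+t
... | inj₂ s≤t = BalancedCover-swap
                   (balancedCover≥ t s p-prime 3≤p p≡1+2h 2≤s s≤t (trans k+3≡s+t (+-comm s t)))

lowerBound : ∀ {p s t} → Prime p → 3 ≤ p → 2 ≤ s → 2 ≤ t → primesBelow p + 3 ≡ s + t →
             GoodBalanced s t (p ∸ 1)
lowerBound {p} p-prime 3≤p 2≤s 2≤t k+3≡s+t =
  subst (GoodBalanced _ _) (cong (_∸ 1) (sym p≡1+2h))
    (BalancedCover⇒GoodBalanced {h = p / 2} (balancedCover _ _ p-prime 3≤p p≡1+2h 2≤s 2≤t k+3≡s+t))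
  where
  p≡1+2h : p ≡ suc (p / 2 * 2)
  p≡1+2h = oddPrime≡1+2h p-prime 3≤p

upperBound : ∀ {p s t n} → Prime p → primesBelow p + 3 ≡ s + t → p ≤ n →
             (c : Colouring n) → HasCoprimeSet c false s ⊎ HasCoprimeSet c true t
upperBound {p} p-prime k+3≡s+t p≤n =
  coprimeList⇒HasCoprimeSet (oneAndPrimesUpTo p) (oneAndPrimesUpTo-unique p)
    (λ v∈ → let (_ , 1≤v , v≤p) = ∈-oneAndPrimesUpTo⁻ 1≤p v∈ in 1≤v , ≤-trans v≤p p≤n)
    (λ v∈ w∈ → unitOrPrime-coprime (proj₁ (∈-oneAndPrimesUpTo⁻ 1≤p v∈))
                                   (proj₁ (∈-oneAndPrimesUpTo⁻ 1≤p w∈)))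
    (≤-reflexive (sym (begin
      suc (length (oneAndPrimesUpTo p)) ≡⟨ cong suc (length-oneAndPrimesUpTo p-prime) ⟩
      3 + primesBelow p                 ≡⟨ +-comm 3 _ ⟩
      primesBelow p + 3                 ≡⟨ k+3≡s+t ⟩
      _                                 ∎)))
  where
  open ≡-Reasoning
  1≤p : 1 ≤ p
  1≤p = >-nonZero⁻¹ p {{prime⇒nonZero p-prime}}

∸1<⇒≤ : ∀ {p n} → 1 ≤ p → p ∸ 1 < n → p ≤ n
∸1<⇒≤ (s≤s z≤n) p∸1<n = p∸1<n

corollary6p4 : (s t : ℕ) → 2 ≤ s → 2 ≤ t → (p : ℕ) → IsNthPrime (s + t ∸ 2) p →
    IsLbal s t (p ∸ 1)
corollary6p4 s t 2≤s 2≤t p (p-prime , 1+k≡s+t∸2) =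
  ≤-trans (s≤s z≤n) (∸-monoˡ-≤ 1 3≤p) ,
  lowerBound p-prime 3≤p 2≤s 2≤t k+3≡s+t ,
  λ { n p∸1<n (c , _ , no-s , no-t) →
        Sum.[ no-s , no-t ] (upperBound p-prime k+3≡s+t (∸1<⇒≤ (≤-trans (s≤s z≤n) 3≤p) p∸1<n) c) }
  where
  k+3≡s+t : primesBelow p + 3 ≡ s + t
  k+3≡s+t = trans (+-suc _ 2) (trans (cong (_+ 2) 1+k≡s+t∸2) (m∸n+n≡m (≤-trans 2≤s (m≤m+n s t))))
  3≤p : 3 ≤ p
  3≤p = 1≤primesBelow⇒3≤p p-prime (+-cancelʳ-≤ 3 1 _ (subst (4 ≤_) (sym k+3≡s+t) (+-mono-≤ 2≤s 2≤t)))
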